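{- Let $n\ge 7$ be odd and $\{n\}\subseteq I\subseteq\{2,3,\ldots,n-2,n\}$. Then $\lambda^I_{(1^n)}-\lambda^I_{(n-1,1)}>\frac n2(n-2)!$.
   Context: For $\emptyset\ne I\subseteq\{2,\ldots,n\}$, $\lambda^I_{(1^n)}=\sum_{k\in I}\binom nk(k-1)!(-1)^{k-1}$ and $\lambda^I_{(n-1,1)}=\sum_{k\in I}\binom nk(k-1)!\frac{n-k-1}{n-1}$; these are the eigenvalues of the Cayley graph on $S_n$ generated by all cycles with length in $I$ corresponding to the sign and standard representations. -}

module Defs where

open import Data.Nat as ℕ using (ℕ; zero; suc; _∸_)
open import Data.Nat.Combinatorics using (_C_)
open import Data.Nat.Base using (_!)
open import Data.Integer as ℤ using (ℤ; +_)
open import Data.Rational using (ℚ; _/_; _*_; _+_; 0ℚ)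
open import Data.List using (List; []; _∷_)

sgn : ℕ → ℤ
sgn zero = + 1
sgn (suc j) = ℤ.- sgn j

signTerm : ℕ → ℕ → ℚ
signTerm n k = (sgn (k ∸ 1) ℤ.* + ((n C k) ℕ.* ((k ∸ 1) !))) / 1

-- the k-th summand of λ^I_{(n-1,1)} : C(n,k) (k-1)! (n-k-1)/(n-1)
-- (n-k-1 is an integer and may be negative, e.g. for k = n).
-- For n ≤ 1 the quantity is undefined; we set it to 0 (irrelevant here).
stdTerm : ℕ → ℕ → ℚ
stdTerm zero k = 0ℚ
stdTerm (suc zero) k = 0ℚ
stdTerm (suc (suc m)) k =
  ((+ ((suc (suc m) C k) ℕ.* ((k ∸ 1) !))) ℤ.* ((+ suc (suc m)) ℤ.- (+ k) ℤ.- (+ 1))) / (suc m)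

sumℚ : (ℕ → ℚ) → List ℕ → ℚ
sumℚ f [] = 0ℚ
sumℚ f (k ∷ ks) = f k + sumℚ f ks

-- eigenvalues for the sign and standard representations;
-- I is given as a duplicate-free list of cycle lengths
λSign : ℕ → List ℕ → ℚ
λSign n I = sumℚ (signTerm n) I

λStd : ℕ → List ℕ → ℚ
λStd n I = sumℚ (stdTerm n) I

module Submission where

-- Multiplying by n − 1 clears all denominators: with c k = C(n,k)(k−1)!, which satisfies
-- c k · k · (n−k)! = n!, the k-th summand of (n − 1)(λSign − λStd) is c k · k for odd k and
-- −c k · (2n − k − 2) for even k. The odd summand at k = n is already n!. The even weights for
-- 2 ≤ k ≤ n − 3 grow at least eightfold from k to k + 2, so (I being duplicate-free) they add up
-- to at most 8/7 of the weight at k = n − 3, which is below 7 n!/16 once n ≥ 7. Hence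
-- (n − 1)(λSign − λStd) > n!/2 = (n − 1) · n (n − 2)!/2.

open import Defs

open import Algebra.Properties.CommutativeSemigroup using (x∙yz≈y∙xz)
open import Data.Integer.Base as ℤ using (ℤ; +_)
import Data.Integer.Properties as ℤ
import Data.Integer.Solver as ℤ-Solver
open import Data.List.Base using (List; []; _∷_; map; filter)
open import Data.List.Membership.Propositional using (_∈_)
open import Data.List.Properties using (filter-all; filter-accept; filter-reject)
open import Data.List.Relation.Unary.All as All using (All; []; _∷_)
open import Data.List.Relation.Unary.All.Properties using (all-filter; filter⁺)
open import Data.List.Relation.Unary.Any using (here; there)
open import Data.List.Relation.Unary.Unique.Propositional using (Unique; []; _∷_)
import Data.List.Relation.Unary.Unique.Propositional.Properties as Unique
open import Data.Nat.Base using (ℕ; zero; suc; _+_; _*_; _∸_; _≤_; _<_; _!; z≤n; s≤s; s≤s⁻¹; parity)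
open import Data.Nat.Combinatorics using (_C_; nCk≡n!/k![n-k]!; k![n∸k]!∣n!; nCn≡1)
open import Data.Nat.DivMod using (_/_; _%_; m/n*n≡m; m≡m%n+[m/n]*n)
open import Data.Nat.ListAction using (sum)
open import Data.Nat.Properties
open import Data.Nat.Solver using (module +-*-Solver)
open import Data.Parity.Base using (Parity; 0ℙ; 1ℙ)
open import Data.Parity.Properties using () renaming (_≟_ to _≟ℙ_)
open import Data.Product.Base using (_×_; _,_)
import Data.Rational.Base as ℚ
import Data.Rational.Properties as ℚ
open import Data.Rational.Unnormalised.Base as ℚᵘ using (mkℚᵘ; *≡*; *<*)
import Data.Rational.Unnormalised.Properties as ℚᵘ
open import Data.Sum.Base using (_⊎_; inj₁; inj₂)
open import Relation.Binary.PropositionalEquality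
open import Relation.Nullary.Decidable using (yes; no; ¬?; from-no)
open import Relation.Nullary.Negation using (¬_; contradiction)

ofParity : Parity → (ℕ → ℕ) → ℕ → ℕ
ofParity p f k with parity k ≟ℙ p
... | yes _ = f k
... | no  _ = 0

ofParity-≡ : ∀ {p} f k → parity k ≡ p → ofParity p f k ≡ f k
ofParity-≡ {p} f k eq with parity k ≟ℙ p
... | yes _ = refl
... | no ne = contradiction eq ne

ofParity-≢ : ∀ {p} f k → ¬ parity k ≡ p → ofParity p f k ≡ 0
ofParity-≢ {p} f k ne with parity k ≟ℙ p
... | yes eq = contradiction eq ne
... | no  _  = refl

parity-even : ∀ j → parity (j * 2) ≡ 0ℙ
parity-even zero    = refl
parity-even (suc j) = parity-even j

parity-odd : ∀ j → parity (suc (j * 2)) ≡ 1ℙ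
parity-odd zero    = refl
parity-odd (suc j) = parity-odd j

odd⇒¬even : ∀ {p} → p ≡ 1ℙ → ¬ p ≡ 0ℙ
odd⇒¬even odd even = contradiction (trans (sym odd) even) λ ()

even⇒¬odd : ∀ {p} → p ≡ 0ℙ → ¬ p ≡ 1ℙ
even⇒¬odd even odd = contradiction (trans (sym even) odd) λ ()

sumBelow : ℕ → (ℕ → ℕ) → ℕ
sumBelow zero    f = 0
sumBelow (suc M) f = sumBelow M f + f M

sumBelow-evens : ∀ J f → sumBelow (J * 2) (ofParity 0ℙ f) ≡ sumBelow J (λ j → f (j * 2))
sumBelow-evens zero    f = refl
sumBelow-evens (suc J) f = begin
  sumBelow (J * 2) f₀ + f₀ (J * 2) + f₀ (suc (J * 2))
    ≡⟨ cong₂ (λ s e → s + e + f₀ (suc (J * 2))) (sumBelow-evens J f) (ofParity-≡ f (J * 2) (parity-even J)) ⟩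
  sumBelow J (λ j → f (j * 2)) + f (J * 2) + f₀ (suc (J * 2))
    ≡⟨ cong (_+_ (sumBelow (suc J) (λ j → f (j * 2)))) (ofParity-≢ f (suc (J * 2)) (odd⇒¬even (parity-odd J))) ⟩
  sumBelow (suc J) (λ j → f (j * 2)) + 0
    ≡⟨ +-identityʳ _ ⟩
  sumBelow (suc J) (λ j → f (j * 2)) ∎
  where
  open ≡-Reasoning
  f₀ = ofParity 0ℙ f

sumBelow-geometric : ∀ r g J → (∀ j → j < J → suc r * g j ≤ g (suc j)) →
                     r * sumBelow (suc J) g ≤ suc r * g J
sumBelow-geometric r g zero    _    = *-monoˡ-≤ (g 0) (n≤1+n r)
sumBelow-geometric r g (suc J) step = begin
  r * (sumBelow (suc J) g + g (suc J))         ≡⟨ *-distribˡ-+ r _ _ ⟩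
  r * sumBelow (suc J) g + r * g (suc J)       ≤⟨ +-monoˡ-≤ _ (sumBelow-geometric r g J (λ j j<J → step j (m<n⇒m<1+n j<J))) ⟩
  suc r * g J + r * g (suc J)                  ≤⟨ +-monoˡ-≤ _ (step J ≤-refl) ⟩
  g (suc J) + r * g (suc J)                    ≡⟨⟩
  suc r * g (suc J)                            ∎
  where open ≤-Reasoning

∈⇒≤sum-map : ∀ (f : ℕ → ℕ) {x I} → x ∈ I → f x ≤ sum (map f I)
∈⇒≤sum-map f {I = x ∷ I} (here refl) = m≤m+n (f x) (sum (map f I))
∈⇒≤sum-map f {I = y ∷ _} (there x∈I) = ≤-trans (∈⇒≤sum-map f x∈I) (m≤n+m _ (f y))

without : ℕ → List ℕ → List ℕ
without x = filter (λ y → ¬? (y ≟ x))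

sum-map-without : ∀ f x {I} → Unique I → sum (map f I) ≤ f x + sum (map f (without x I))
sum-map-without f x {[]} [] = z≤n
sum-map-without f x {y ∷ I} (y∉I ∷ u) with y ≟ x
... | yes refl = ≤-reflexive (cong (λ J → f y + sum (map f J)) (begin
  I                    ≡⟨ filter-all (λ z → ¬? (z ≟ y)) (All.map (λ y≢z z≡y → y≢z (sym z≡y)) y∉I) ⟨
  without y I          ≡⟨ filter-reject (λ z → ¬? (z ≟ y)) (λ y≢y → y≢y refl) ⟨
  without y (y ∷ I)    ∎))
  where open ≡-Reasoning
... | no y≢x = begin
  f y + sum (map f I)                         ≤⟨ +-monoʳ-≤ (f y) (sum-map-without f x u) ⟩
  f y + (f x + sum (map f (without x I)))     ≡⟨ x∙yz≈y∙xz +-commutativeSemigroup (f y) (f x) _ ⟩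
  f x + sum (map f (y ∷ without x I))         ≡⟨ cong (λ J → f x + sum (map f J)) (filter-accept (λ z → ¬? (z ≟ x)) y≢x) ⟨
  f x + sum (map f (without x (y ∷ I)))       ∎
  where open ≤-Reasoning

sum-map-≤-sumBelow : ∀ f M {I} → Unique I → All (λ k → k < M ⊎ f k ≡ 0) I →
                     sum (map f I) ≤ sumBelow M f
sum-map-≤-sumBelow f zero    {[]}    []      []                = z≤n
sum-map-≤-sumBelow f zero    {y ∷ I} (_ ∷ u) (inj₂ fy≡0 ∷ ks) =
  ≤-trans (≤-reflexive (cong (_+ sum (map f I)) fy≡0)) (sum-map-≤-sumBelow f zero u ks)
sum-map-≤-sumBelow f (suc M) {I}     u       ks                = begin
  sum (map f I)                        ≤⟨ sum-map-without f M u ⟩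
  f M + sum (map f (without M I))      ≤⟨ +-monoʳ-≤ (f M) (sum-map-≤-sumBelow f M (Unique.filter⁺ _ u) ks′) ⟩
  f M + sumBelow M f                   ≡⟨ +-comm (f M) _ ⟩
  sumBelow (suc M) f                   ∎
  where
  open ≤-Reasoning
  shrink : ∀ {k} → (k < suc M ⊎ f k ≡ 0) × ¬ k ≡ M → k < M ⊎ f k ≡ 0
  shrink (inj₁ k<1+M , k≢M) = inj₁ (≤∧≢⇒< (s≤s⁻¹ k<1+M) k≢M)
  shrink (inj₂ fk≡0  , _)   = inj₂ fk≡0
  ks′ : All (λ k → k < M ⊎ f k ≡ 0) (without M I)
  ks′ = All.map shrink (All.zip (filter⁺ _ ks , all-filter (λ z → ¬? (z ≟ M)) I))

sumℤ : (ℕ → ℤ) → List ℕ → ℤ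
sumℤ f []       = + 0
sumℤ f (k ∷ ks) = f k ℤ.+ sumℤ f ks

sumℤ-*-difference : ∀ (f g : ℕ → ℤ) c (p q : ℕ → ℕ) {I} →
  All (λ k → f k ℤ.* c ℤ.- g k ≡ + p k ℤ.- + q k) I →
  sumℤ f I ℤ.* c ℤ.- sumℤ g I ≡ + sum (map p I) ℤ.- + sum (map q I)
sumℤ-*-difference f g c p q []                 = refl
sumℤ-*-difference f g c p q {k ∷ I} (eq ∷ eqs) = begin
  (f k ℤ.+ sumℤ f I) ℤ.* c ℤ.- (g k ℤ.+ sumℤ g I)
    ≡⟨ solve 5 (λ a b x y c → (a :+ x) :* c :- (b :+ y) := (a :* c :- b) :+ (x :* c :- y)) refl
              (f k) (g k) (sumℤ f I) (sumℤ g I) c ⟩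
  (f k ℤ.* c ℤ.- g k) ℤ.+ (sumℤ f I ℤ.* c ℤ.- sumℤ g I)
    ≡⟨ cong₂ ℤ._+_ eq (sumℤ-*-difference f g c p q eqs) ⟩
  (+ p k ℤ.- + q k) ℤ.+ (+ sum (map p I) ℤ.- + sum (map q I))
    ≡⟨ solve 4 (λ a b x y → (a :- b) :+ (x :- y) := (a :+ x) :- (b :+ y)) refl
              (+ p k) (+ q k) (+ sum (map p I)) (+ sum (map q I)) ⟩
  (+ p k ℤ.+ + sum (map p I)) ℤ.- (+ q k ℤ.+ + sum (map q I))
    ≡⟨ sym (cong₂ ℤ._-_ (ℤ.pos-+ (p k) _) (ℤ.pos-+ (q k) _)) ⟩
  + sum (map p (k ∷ I)) ℤ.- + sum (map q (k ∷ I)) ∎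
  where
  open ≡-Reasoning
  open ℤ-Solver.+-*-Solver

toℚᵘ-sumℚ : ∀ m (f : ℕ → ℤ) I → ℚ.toℚᵘ (sumℚ (λ k → f k ℚ./ suc m) I) ℚᵘ.≃ mkℚᵘ (sumℤ f I) m
toℚᵘ-sumℚ m f []      = *≡* refl
toℚᵘ-sumℚ m f (k ∷ I) = begin
  ℚ.toℚᵘ (f k ℚ./ suc m ℚ.+ sumℚ (λ k → f k ℚ./ suc m) I)
    ≈⟨ ℚ.toℚᵘ-homo-+ (f k ℚ./ suc m) _ ⟩
  ℚ.toℚᵘ (f k ℚ./ suc m) ℚᵘ.+ ℚ.toℚᵘ (sumℚ (λ k → f k ℚ./ suc m) I)
    ≈⟨ ℚᵘ.+-cong (ℚ.toℚᵘ-fromℚᵘ (mkℚᵘ (f k) m)) (toℚᵘ-sumℚ m f I) ⟩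
  mkℚᵘ (f k) m ℚᵘ.+ mkℚᵘ (sumℤ f I) m
    ≈⟨ *≡* (solve 3 (λ u v d → (u :* d :+ v :* d) :* d := (u :+ v) :* (d :* d)) refl (f k) (sumℤ f I) (+ suc m)) ⟩
  mkℚᵘ (sumℤ f (k ∷ I)) m ∎
  where
  open ℚᵘ.≃-Reasoning
  open ℤ-Solver.+-*-Solver

toℚᵘ-sumℚ-difference : ∀ m (f g : ℕ → ℤ) I →
  ℚ.toℚᵘ (sumℚ (λ k → f k ℚ./ 1) I ℚ.- sumℚ (λ k → g k ℚ./ suc m) I)
    ℚᵘ.≃ mkℚᵘ (sumℤ f I ℤ.* + suc m ℤ.- sumℤ g I) m
toℚᵘ-sumℚ-difference m f g I = begin
  ℚ.toℚᵘ (F ℚ.- G)                            ≈⟨ ℚ.toℚᵘ-homo-+ F (ℚ.- G) ⟩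
  ℚ.toℚᵘ F ℚᵘ.+ ℚ.toℚᵘ (ℚ.- G)                ≈⟨ ℚᵘ.+-cong (toℚᵘ-sumℚ 0 f I) (ℚ.toℚᵘ-homo‿- G) ⟩
  mkℚᵘ (sumℤ f I) 0 ℚᵘ.- ℚ.toℚᵘ G             ≈⟨ ℚᵘ.+-congʳ _ (ℚᵘ.-‿cong (toℚᵘ-sumℚ m g I)) ⟩
  mkℚᵘ (sumℤ f I) 0 ℚᵘ.- mkℚᵘ (sumℤ g I) m    ≈⟨ *≡* (common-denominator (sumℤ f I) (sumℤ g I)) ⟩
  mkℚᵘ (sumℤ f I ℤ.* + suc m ℤ.- sumℤ g I) m  ∎
  where
  open ℚᵘ.≃-Reasoning
  F = sumℚ (λ k → f k ℚ./ 1) I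
  G = sumℚ (λ k → g k ℚ./ suc m) I
  common-denominator : ∀ a b → (a ℤ.* + suc m ℤ.+ ℤ.- b ℤ.* + 1) ℤ.* + suc m ≡ (a ℤ.* + suc m ℤ.- b) ℤ.* + suc (m + 0)
  common-denominator a b rewrite +-identityʳ m =
    solve 3 (λ a b d → (a :* d :+ (:- b) :* con (+ 1)) :* d := (a :* d :- b) :* d) refl a b (+ suc m)
    where open ℤ-Solver.+-*-Solver

/2-<-sumℚ-difference : ∀ m (f g : ℕ → ℤ) I x →
  x ℤ.* + suc m ℤ.< (sumℤ f I ℤ.* + suc m ℤ.- sumℤ g I) ℤ.* + 2 →
  x ℚ./ 2 ℚ.< sumℚ (λ k → f k ℚ./ 1) I ℚ.- sumℚ (λ k → g k ℚ./ suc m) I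
/2-<-sumℚ-difference m f g I x lt = ℚ.toℚᵘ-cancel-<
  (ℚᵘ.<-respʳ-≃ (ℚᵘ.≃-sym (toℚᵘ-sumℚ-difference m f g I))
    (ℚᵘ.<-respˡ-≃ (ℚᵘ.≃-sym (ℚ.toℚᵘ-fromℚᵘ (mkℚᵘ x 1))) (*<* lt)))

doubled-difference : ∀ {M P N} → M ≤ P → 2 * N < M → + M ℤ.< (+ P ℤ.- + N) ℤ.* + 2
doubled-difference {M} {P} {N} M≤P 2N<M =
  subst (+ M ℤ.<_) (sym [P-N]*2) (ℤ.+<+ (m+n≤o⇒m≤o∸n (suc M) (begin
    suc M + 2 * N    ≡⟨ +-suc M (2 * N) ⟨
    M + suc (2 * N)  ≤⟨ +-monoʳ-≤ M 2N<M ⟩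
    M + M            ≤⟨ +-mono-≤ M≤P M≤P ⟩
    P + P            ≡⟨ cong (_+_ P) (+-identityʳ P) ⟨
    2 * P            ∎)))
  where
  open ≤-Reasoning
  N≤P : N ≤ P
  N≤P = ≤-trans (m≤m+n N (N + 0)) (≤-trans (<⇒≤ 2N<M) M≤P)
  [P-N]*2 : (+ P ℤ.- + N) ℤ.* + 2 ≡ + (2 * P ∸ 2 * N)
  [P-N]*2 = trans (cong (ℤ._* + 2) (trans (ℤ.m-n≡m⊖n P N) (ℤ.⊖-≥ N≤P)))
            (trans (sym (ℤ.pos-* (P ∸ N) 2))
                   (cong +_ (trans (*-comm (P ∸ N) 2) (*-distribˡ-∸ 2 P N))))

cycleCount : ℕ → ℕ → ℕ
cycleCount n k = (n C k) * ((k ∸ 1) !)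

cycleCount-*-! : ∀ {n k} → suc k ≤ n → cycleCount n (suc k) * suc k * (n ∸ suc k) ! ≡ n !
cycleCount-*-! {n} {k} k<n = begin
  (n C suc k) * k ! * suc k * (n ∸ suc k) !
    ≡⟨ solve 4 (λ c f j g → c :* f :* (con 1 :+ j) :* g := c :* ((con 1 :+ j) :* f :* g)) refl
              (n C suc k) (k !) k ((n ∸ suc k) !) ⟩
  (n C suc k) * (suc k ! * (n ∸ suc k) !)
    ≡⟨ cong (_* (suc k ! * (n ∸ suc k) !)) (nCk≡n!/k![n-k]! k<n) ⟩
  n ! / (suc k ! * (n ∸ suc k) !) * (suc k ! * (n ∸ suc k) !)
    ≡⟨ m/n*n≡m (k![n∸k]!∣n! k<n) ⟩
  n ! ∎
  where
  open ≡-Reasoning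
  open +-*-Solver
  instance _ = suc k !* (n ∸ suc k) !≢0

cycleCount-full : ∀ m → cycleCount (suc m) (suc m) * suc m ≡ suc m !
cycleCount-full m rewrite nCn≡1 (suc m) | +-identityʳ (m !) = *-comm (m !) (suc m)

-- Only k ≥ 1 occurs in the theorem; the value 0 at k = 0 lets the chain of even weights start at 0.
evenWeight : ℕ → ℕ → ℕ
evenWeight n zero      = 0
evenWeight n k@(suc _) = cycleCount n k * (n + (n ∸ (2 + k)))

∸-≡ : ∀ {n} m {o} → n ≡ m + o → n ∸ m ≡ o
∸-≡ m {o} refl = m+n∸m≡n m o

evenWeight-step-arith : ∀ a b c c′ → c′ * (4 + a) ≡ c * ((2 + a) * (5 + b) * (4 + b)) →
                        8 * (c * (7 + a + b + (3 + b))) ≤ c′ * (7 + a + b + (1 + b))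
evenWeight-step-arith a b c c′ eq = *-cancelˡ-≤ (4 + a) (begin
  (4 + a) * (8 * (c * (7 + a + b + (3 + b))))
    ≤⟨ m≤m+n _ (c * slack) ⟩
  (4 + a) * (8 * (c * (7 + a + b + (3 + b)))) + c * slack
    ≡⟨ solve 3 (λ a b c → (con 4 :+ a) :* (con 8 :* (c :* (con 7 :+ a :+ b :+ (con 3 :+ b)))) :+ c :* slack′ a b
                        := c :* ((con 2 :+ a) :* (con 5 :+ b) :* (con 4 :+ b)) :* (con 7 :+ a :+ b :+ (con 1 :+ b)))
             refl a b c ⟩
  c * ((2 + a) * (5 + b) * (4 + b)) * (7 + a + b + (1 + b))
    ≡⟨ cong (_* (7 + a + b + (1 + b))) eq ⟨
  c′ * (4 + a) * (7 + a + b + (1 + b))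
    ≡⟨ solve 3 (λ a b c′ → c′ :* (con 4 :+ a) :* (con 7 :+ a :+ b :+ (con 1 :+ b))
                         := (con 4 :+ a) :* (c′ :* (con 7 :+ a :+ b :+ (con 1 :+ b)))) refl a b c′ ⟩
  (4 + a) * (c′ * (7 + a + b + (1 + b))) ∎)
  where
  open ≤-Reasoning
  open +-*-Solver
  -- c * slack is the gap between the two sides multiplied by 4 + a; its coefficients are nonnegative.
  slack′ : ∀ {k} → Polynomial k → Polynomial k → Polynomial k
  slack′ a b = a :* a :* b :* b :+ con 9 :* a :* a :* b :+ con 12 :* a :* a :+ con 2 :* a :* b :* b :* b
             :+ con 28 :* a :* b :* b :+ con 114 :* a :* b :+ con 88 :* a :+ con 4 :* b :* b :* b
             :+ con 52 :* b :* b :+ con 160 :* b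
  slack : ℕ
  slack = a * a * b * b + 9 * a * a * b + 12 * a * a + 2 * a * b * b * b
        + 28 * a * b * b + 114 * a * b + 88 * a + 4 * b * b * b
        + 52 * b * b + 160 * b

evenWeight-step : ∀ {n} a → 7 + a ≤ n → 8 * evenWeight n (2 + a) ≤ evenWeight n (4 + a)
evenWeight-step {n} a 7+a≤n with n ∸ (7 + a) | m+[n∸m]≡n 7+a≤n
... | b | refl = subst₂ (λ r s → 8 * (c₂ * (n + r)) ≤ c₄ * (n + s)) (sym n∸[4+a]) (sym n∸[6+a])
                        (evenWeight-step-arith a b c₂ c₄ ratio)
  where
  open +-*-Solver
  c₂ = cycleCount n (2 + a)
  c₄ = cycleCount n (4 + a)
  n∸[2+a] : n ∸ (2 + a) ≡ 5 + b
  n∸[2+a] = ∸-≡ (2 + a) (solve 2 (λ a b → con 7 :+ a :+ b := (con 2 :+ a) :+ (con 5 :+ b)) refl a b)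
  n∸[4+a] : n ∸ (4 + a) ≡ 3 + b
  n∸[4+a] = ∸-≡ (4 + a) (solve 2 (λ a b → con 7 :+ a :+ b := (con 4 :+ a) :+ (con 3 :+ b)) refl a b)
  n∸[6+a] : n ∸ (6 + a) ≡ 1 + b
  n∸[6+a] = ∸-≡ (6 + a) (solve 2 (λ a b → con 7 :+ a :+ b := (con 6 :+ a) :+ (con 1 :+ b)) refl a b)
  ratio : c₄ * (4 + a) ≡ c₂ * ((2 + a) * (5 + b) * (4 + b))
  ratio = *-cancelʳ-≡ _ _ ((3 + b) !) {{(3 + b) !≢0}} (begin
    c₄ * (4 + a) * (3 + b) !                        ≡⟨ cong (λ r → c₄ * (4 + a) * r !) n∸[4+a] ⟨
    c₄ * (4 + a) * (n ∸ (4 + a)) !                  ≡⟨ cycleCount-*-! (+-monoʳ-≤ 4 (≤-trans (m≤m+n a b) (m≤n+m _ 3))) ⟩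
    n !                                             ≡⟨ cycleCount-*-! (+-monoʳ-≤ 2 (≤-trans (m≤m+n a b) (m≤n+m _ 5))) ⟨
    c₂ * (2 + a) * (n ∸ (2 + a)) !                  ≡⟨ cong (λ r → c₂ * (2 + a) * r !) n∸[2+a] ⟩
    c₂ * (2 + a) * ((5 + b) * ((4 + b) * (3 + b) !)) ≡⟨ solve 5 (λ c a x y f → c :* a :* (x :* (y :* f)) := c :* (a :* x :* y) :* f)
                                                               refl c₂ (2 + a) (5 + b) (4 + b) ((3 + b) !) ⟩
    c₂ * ((2 + a) * (5 + b) * (4 + b)) * (3 + b) !   ∎)
    where open ≡-Reasoning

evenWeight-top : ∀ a → 16 * evenWeight (7 + a) (4 + a) < 7 * (7 + a) !
evenWeight-top a = subst (λ r → 16 * (c * (7 + a + r)) < 7 * (7 + a) !)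
                         (sym (∸-≡ (6 + a) (+-comm 1 (6 + a))))
                         (bound c full)
  where
  open +-*-Solver
  c = cycleCount (7 + a) (4 + a)
  full : c * (4 + a) * 6 ≡ (7 + a) !
  full = trans (cong (λ r → c * (4 + a) * r !) (sym (∸-≡ (4 + a) (+-comm 3 (4 + a)))))
               (cycleCount-*-! (+-monoʳ-≤ 4 (m≤n+m a 3)))
  bound : ∀ x → x * (4 + a) * 6 ≡ (7 + a) ! → 16 * (x * (7 + a + 1)) < 7 * (7 + a) !
  bound zero    eq = contradiction (sym eq) (>⇒≢ (1≤n! (7 + a)))
  bound (suc x) eq = begin-strict
    16 * (suc x * (7 + a + 1))
      <⟨ m<m+n _ (s≤s z≤n) ⟩
    16 * (suc x * (7 + a + 1)) + (40 + (x * 40 + 26 * (suc x * a)))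
      ≡⟨ solve 2 (λ x a → con 16 :* ((con 1 :+ x) :* (con 7 :+ a :+ con 1)) :+ (con 40 :+ (x :* con 40 :+ con 26 :* ((con 1 :+ x) :* a)))
                        := con 7 :* ((con 1 :+ x) :* (con 4 :+ a) :* con 6)) refl x a ⟩
    7 * (suc x * (4 + a) * 6)
      ≡⟨ cong (7 *_) eq ⟩
    7 * (7 + a) ! ∎
    where open ≤-Reasoning

-- By definition, signTerm n k and stdTerm (suc (suc m)) k are these numerators over 1 and over suc m.
signNumerator : ℕ → ℕ → ℤ
signNumerator n k = sgn (k ∸ 1) ℤ.* + cycleCount n k

standardNumerator : ℕ → ℕ → ℤ
standardNumerator n k = + cycleCount n k ℤ.* (+ n ℤ.- + k ℤ.- + 1)

positivePart : ℕ → ℕ → ℕ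
positivePart n = ofParity 1ℙ (λ k → cycleCount n k * k)

negativePart : ℕ → ℕ → ℕ
negativePart n = ofParity 0ℙ (evenWeight n)

sgn-pred-odd : ∀ j → parity (suc j) ≡ 1ℙ → sgn j ≡ + 1
sgn-pred-odd zero          _ = refl
sgn-pred-odd (suc (suc j)) p = trans (ℤ.neg-involutive (sgn j)) (sgn-pred-odd j p)

sgn-pred-even : ∀ j → parity (suc j) ≡ 0ℙ → sgn j ≡ ℤ.- + 1
sgn-pred-even (suc zero)    _ = refl
sgn-pred-even (suc (suc j)) p = trans (ℤ.neg-involutive (sgn j)) (sgn-pred-even j p)

difference-odd : ∀ m j → parity (suc j) ≡ 1ℙ →
  signNumerator (suc m) (suc j) ℤ.* + m ℤ.- standardNumerator (suc m) (suc j)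
    ≡ + (cycleCount (suc m) (suc j) * suc j)
difference-odd m j p rewrite sgn-pred-odd j p = trans
  (solve 3 (λ c m j → con (+ 1) :* c :* m :- c :* ((con (+ 1) :+ m) :- (con (+ 1) :+ j) :- con (+ 1))
                   := c :* (con (+ 1) :+ j)) refl (+ cycleCount (suc m) (suc j)) (+ m) (+ j))
  (sym (ℤ.pos-* (cycleCount (suc m) (suc j)) (suc j)))
  where open ℤ-Solver.+-*-Solver

difference-even : ∀ m j → parity (suc j) ≡ 0ℙ → 2 + suc j ≤ suc m →
  signNumerator (suc m) (suc j) ℤ.* + m ℤ.- standardNumerator (suc m) (suc j)
    ≡ ℤ.- + evenWeight (suc m) (suc j)
difference-even m j p k+2≤n rewrite sgn-pred-even j p
  with suc m ∸ (2 + suc j) | m+[n∸m]≡n k+2≤n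
... | r | refl = trans
  (solve 3 (λ c j r → con (ℤ.- + 1) :* c :* (con (+ 2) :+ j :+ r)
                      :- c :* ((con (+ 1) :+ (con (+ 2) :+ j :+ r)) :- (con (+ 1) :+ j) :- con (+ 1))
                   := :- (c :* ((con (+ 1) :+ (con (+ 2) :+ j :+ r)) :+ r)))
         refl (+ cycleCount (3 + j + r) (suc j)) (+ j) (+ r))
  (cong ℤ.-_ (sym (ℤ.pos-* (cycleCount (3 + j + r) (suc j)) _)))
  where open ℤ-Solver.+-*-Solver

parts-odd : ∀ n k → parity k ≡ 1ℙ →
  + positivePart n k ℤ.- + negativePart n k ≡ + (cycleCount n k * k)
parts-odd n k p = trans
  (cong₂ (λ x y → + x ℤ.- + y) (ofParity-≡ (λ k → cycleCount n k * k) k p)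
                                (ofParity-≢ (evenWeight n) k (odd⇒¬even p)))
  (ℤ.+-identityʳ _)

parts-even : ∀ n k → parity k ≡ 0ℙ →
  + positivePart n k ℤ.- + negativePart n k ≡ ℤ.- + evenWeight n k
parts-even n k p = trans
  (cong₂ (λ x y → + x ℤ.- + y) (ofParity-≢ (λ k → cycleCount n k * k) k (even⇒¬odd p))
                                (ofParity-≡ (evenWeight n) k p))
  (ℤ.+-identityˡ _)

difference-parts : ∀ m k → parity (suc m) ≡ 1ℙ → (2 ≤ k × k ≤ suc m ∸ 2) ⊎ k ≡ suc m →
  signNumerator (suc m) k ℤ.* + m ℤ.- standardNumerator (suc m) k
    ≡ + positivePart (suc m) k ℤ.- + negativePart (suc m) k
difference-parts m .(suc m) n-odd (inj₂ refl) = trans (difference-odd m m n-odd) (sym (parts-odd (suc m) (suc m) n-odd))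
difference-parts m zero    _ (inj₁ (() , _))
difference-parts m (suc j) _ (inj₁ (2≤k , k≤n-2)) = by-parity (parity (suc j)) refl
  where
  k+2≤n : 2 + suc j ≤ suc m
  k+2≤n = subst (_≤ suc m) (+-comm (suc j) 2)
            (m≤o∸n⇒m+n≤o (suc j) (≤-trans 2≤k (≤-trans k≤n-2 (m∸n≤m (suc m) 2))) k≤n-2)
  by-parity : ∀ q → parity (suc j) ≡ q →
    signNumerator (suc m) (suc j) ℤ.* + m ℤ.- standardNumerator (suc m) (suc j)
      ≡ + positivePart (suc m) (suc j) ℤ.- + negativePart (suc m) (suc j)
  by-parity 1ℙ p = trans (difference-odd m j p) (sym (parts-odd (suc m) (suc j) p))
  by-parity 0ℙ p = trans (difference-even m j p k+2≤n) (sym (parts-even (suc m) (suc j) p))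

positivePart-sum : ∀ m {I} → parity (suc m) ≡ 1ℙ → suc m ∈ I →
                   suc m ! ≤ sum (map (positivePart (suc m)) I)
positivePart-sum m {I} n-odd n∈I = subst (_≤ sum (map (positivePart (suc m)) I))
  (trans (ofParity-≡ (λ k → cycleCount (suc m) k * k) (suc m) n-odd) (cycleCount-full m))
  (∈⇒≤sum-map (positivePart (suc m)) n∈I)

negativePart-sum : ∀ t {I} → let n = 7 + t * 2 in
  Unique I → All (λ k → (2 ≤ k × k ≤ n ∸ 2) ⊎ k ≡ n) I →
  2 * sum (map (negativePart n) I) < n !
negativePart-sum t {I} unique allowed = *-cancelˡ-< 7 _ _ (begin-strict
  7 * (2 * S)                          ≡⟨ x∙yz≈y∙xz *-commutativeSemigroup 7 2 S ⟩
  2 * (7 * S)                          ≤⟨ *-monoʳ-≤ 2 (*-monoʳ-≤ 7 S≤chain) ⟩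
  2 * (7 * sumBelow (3 + t) chain)     ≤⟨ *-monoʳ-≤ 2 (sumBelow-geometric 7 chain (2 + t) chain-step) ⟩
  2 * (8 * chain (2 + t))              ≡⟨ *-assoc 2 8 (chain (2 + t)) ⟨
  16 * evenWeight n (4 + t * 2)        <⟨ evenWeight-top (t * 2) ⟩
  7 * n !                              ∎)
  where
  open ≤-Reasoning
  n = 7 + t * 2
  S = sum (map (negativePart n) I)
  chain : ℕ → ℕ
  chain j = evenWeight n (j * 2)
  below : ∀ {k} → (2 ≤ k × k ≤ n ∸ 2) ⊎ k ≡ n → k < 6 + t * 2 ⊎ negativePart n k ≡ 0
  below (inj₁ (_ , k≤n-2)) = inj₁ (s≤s k≤n-2)
  below (inj₂ refl)        = inj₂ (ofParity-≢ (evenWeight n) n (odd⇒¬even (parity-odd (3 + t))))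
  S≤chain : S ≤ sumBelow (3 + t) chain
  S≤chain = subst (S ≤_) (sumBelow-evens (3 + t) (evenWeight n))
                  (sum-map-≤-sumBelow (negativePart n) (6 + t * 2) unique (All.map below allowed))
  chain-step : ∀ j → j < 2 + t → 8 * chain j ≤ chain (suc j)
  chain-step zero    _   = z≤n
  chain-step (suc i) 1+i<2+t = evenWeight-step (i * 2) (+-monoʳ-≤ 7 (*-monoˡ-≤ 2 (s≤s⁻¹ (s≤s⁻¹ 1+i<2+t))))

n%2≡1⇒n≡1+[n/2]*2 : ∀ {n} → n % 2 ≡ 1 → n ≡ 1 + n / 2 * 2
n%2≡1⇒n≡1+[n/2]*2 {n} n-odd = trans (m≡m%n+[m/n]*n n 2) (cong (_+ n / 2 * 2) n-odd)

lemma5p1 : (n : ℕ) → 7 ≤ n → n % 2 ≡ 1 → (I : List ℕ) → Unique I → n ∈ I →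
    All (λ k → (2 ≤ k × k ≤ n ∸ 2) ⊎ k ≡ n) I →
    (+ (n * ((n ∸ 2) !))) ℚ./ 2 ℚ.< λSign n I ℚ.- λStd n I
lemma5p1 n 7≤n n-odd I unique n∈I allowed with n / 2 | n%2≡1⇒n≡1+[n/2]*2 {n} n-odd
... | 0 | refl = contradiction 7≤n (from-no (7 ≤? 1))
... | 1 | refl = contradiction 7≤n (from-no (7 ≤? 3))
... | 2 | refl = contradiction 7≤n (from-no (7 ≤? 5))
... | suc (suc (suc t)) | refl =
  /2-<-sumℚ-difference m (signNumerator n) (standardNumerator n) I (+ (n * m !))
    (subst₂ ℤ._<_ n!≡ (cong (ℤ._* + 2) (sym parts))
      (doubled-difference {N = sum (map (negativePart n) I)}
        (positivePart-sum (suc m) (parity-odd (3 + t)) n∈I) (negativePart-sum t unique allowed)))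
  where
  m = 5 + t * 2
  parts : sumℤ (signNumerator n) I ℤ.* + suc m ℤ.- sumℤ (standardNumerator n) I
        ≡ + sum (map (positivePart n) I) ℤ.- + sum (map (negativePart n) I)
  parts = sumℤ-*-difference _ _ (+ suc m) (positivePart n) (negativePart n)
            (All.map (difference-parts (suc m) _ (parity-odd (3 + t))) allowed)
  n!≡ : + (n !) ≡ + (n * m !) ℤ.* + suc m
  n!≡ = trans (cong +_ (solve 3 (λ n m f → n :* ((con 1 :+ m) :* f) := n :* f :* (con 1 :+ m)) refl n m (m !)))
              (ℤ.pos-* (n * m !) (suc m))
    where open +-*-Solver
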